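{- Let $d\ge 1$, let $S$ be an edge metric generator of the hypercube $Q_d$, and let $s$ be an arbitrary element of $S$. Then $S\cup\{s\oplus\alpha_1\}$ is a metric generator of $Q_d$.
   Context: The hypercube $Q_d$ has vertex set $\{0,1\}^d$, two vertices adjacent iff they differ in exactly one coordinate; the distance $d(u,v)$ is the number of coordinates in which $u,v$ differ. $\alpha_1$ is the vector with $1$ in the first coordinate and $0$ elsewhere, and $\oplus$ is coordinatewise XOR, so $s\oplus\alpha_1$ is $s$ with the first coordinate flipped. For a vertex $x$ and an edge $uv$, $d(uv,x)=\min\{d(u,x),d(v,x)\}$. A set $S$ of vertices is a metric generator if for every two distinct vertices $u,v$ some $s\in S$ has $d(u,s)\ne d(v,s)$; it is an edge metric generator if for every two distinct edges $e_1,e_2$ some $s\in S$ has $d(e_1,s)\ne d(e_2,s)$. -}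

module Defs where

open import Data.Nat using (ℕ; zero; suc; _+_)
open import Data.Bool using (Bool; true; false; not; _xor_)
open import Data.Vec using (Vec; []; _∷_; zipWith; replicate)
open import Data.Nat using (_⊓_)
open import Data.List using (List)
open import Data.List.Membership.Propositional using (_∈_)
open import Data.Product using (Σ; ∃; _×_; _,_)
open import Relation.Binary.PropositionalEquality using (_≡_; _≢_)
open import Relation.Nullary using (¬_)
open import Data.Sum using (_⊎_)

Vertex : ℕ → Set
Vertex d = Vec Bool d

dist : ∀ {d} → Vertex d → Vertex d → ℕ
dist [] [] = 0
dist (a ∷ u) (b ∷ v) with a Data.Bool.≟ b
... | Relation.Nullary.yes _ = dist u v
... | Relation.Nullary.no _ = suc (dist u v)

_⊕_ : ∀ {d} → Vertex d → Vertex d → Vertex d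
_⊕_ = zipWith _xor_

α₁ : ∀ {n} → Vertex (suc n)
α₁ = true ∷ replicate _ false

-- an edge of Q_d: an (ordered representative of an) adjacent pair
Edge : ℕ → Set
Edge d = Σ (Vertex d) λ u → Σ (Vertex d) λ v → dist u v ≡ 1

SameEdge : ∀ {d} → Edge d → Edge d → Set
SameEdge (u , v , _) (u' , v' , _) = (u ≡ u' × v ≡ v') ⊎ (u ≡ v' × v ≡ u')

edgeDist : ∀ {d} → Edge d → Vertex d → ℕ
edgeDist (u , v , _) x = dist u x ⊓ dist v x

IsMetricGenerator : ∀ {d} → List (Vertex d) → Set
IsMetricGenerator {d} S =
  (u v : Vertex d) → u ≢ v → ∃ λ s → s ∈ S × dist u s ≢ dist v s

IsEdgeMetricGenerator : ∀ {d} → List (Vertex d) → Set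
IsEdgeMetricGenerator {d} S =
  (e₁ e₂ : Edge d) → ¬ SameEdge e₁ e₂ →
  ∃ λ s → s ∈ S × edgeDist e₁ s ≢ edgeDist e₂ s

-- The edges in direction 1, a ∷ u — not a ∷ u,
-- see a vertex c ∷ t at distance exactly d(u, t), so edges at distinct u and v resolve precisely the
-- pairs a ∷ u, a ∷ v that agree in the first coordinate. A pair a ∷ u, not a ∷ v tied by s is
-- resolved by s ⊕ α₁: flipping the first coordinate of s moves the two distances in opposite
-- directions, so equal distances become distances differing by 2.
module Submission where

open import Defs
open import Data.Bool using (Bool; true; false; not)
import Data.Bool as Bool
open import Data.Bool.Properties using (xor-identityʳ; not-¬; ¬-not)
open import Data.List using (List; _∷_)
open import Data.List.Membership.Propositional using (_∈_)
open import Data.List.Relation.Unary.Any using (here; there)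
open import Data.Nat using (ℕ; suc)
open import Data.Nat.Properties
  using (_≟_; suc-injective; n≤1+n; m≤n⇒m⊓n≡m; m≥n⇒m⊓n≡n; m≢1+n+m)
open import Data.Product using (_,_)
open import Data.Sum using (inj₁; inj₂)
open import Function using (_∘_)
open import Data.Vec using ([]; _∷_)
open import Data.Vec.Properties using (zipWith-identityʳ; ∷-injectiveˡ)
open import Relation.Binary.PropositionalEquality
  using (_≡_; _≢_; refl; sym; trans; cong; subst; module ≡-Reasoning)
open import Relation.Nullary using (¬_; yes; no)

private
  variable
    n : ℕ

dist-refl : (u : Vertex n) → dist u u ≡ 0
dist-refl []          = refl
dist-refl (false ∷ u) = dist-refl u
dist-refl (true ∷ u)  = dist-refl u

dist-∷-cancel : ∀ a c (u v t : Vertex n) →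
  dist (a ∷ u) (c ∷ t) ≡ dist (a ∷ v) (c ∷ t) → dist u t ≡ dist v t
dist-∷-cancel a c u v t with a Bool.≟ c
... | yes _ = λ eq → eq
... | no  _ = suc-injective

⊕-α₁ : ∀ c (t : Vertex n) → (c ∷ t) ⊕ α₁ ≡ not c ∷ t
⊕-α₁ false t = cong (true ∷_)  (zipWith-identityʳ xor-identityʳ t)
⊕-α₁ true  t = cong (false ∷_) (zipWith-identityʳ xor-identityʳ t)

m≢2+m : ∀ {m} → m ≢ suc (suc m)
m≢2+m {m} = m≢1+n+m m {1}

flip-head-resolves : ∀ a c (u v t : Vertex n) →
  dist (a ∷ u) (c ∷ t) ≡ dist (not a ∷ v) (c ∷ t) →
  dist (a ∷ u) (not c ∷ t) ≢ dist (not a ∷ v) (not c ∷ t)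
flip-head-resolves false false u v t tie eq = m≢2+m (trans tie (cong suc (sym eq)))
flip-head-resolves false true  u v t tie eq = m≢2+m (trans eq (cong suc (sym tie)))
flip-head-resolves true  false u v t tie eq = m≢2+m (trans eq (cong suc (sym tie)))
flip-head-resolves true  true  u v t tie eq = m≢2+m (trans tie (cong suc (sym eq)))

⊕-α₁-resolves : ∀ {a b} (u v : Vertex n) s → a ≢ b →
  dist (a ∷ u) s ≡ dist (b ∷ v) s → dist (a ∷ u) (s ⊕ α₁) ≢ dist (b ∷ v) (s ⊕ α₁)
⊕-α₁-resolves {a = a} u v (c ∷ t) a≢b tie with refl ← ¬-not (a≢b ∘ sym)
  = subst (λ x → dist (a ∷ u) x ≢ dist (not a ∷ v) x) (sym (⊕-α₁ c t))
          (flip-head-resolves a c u v t tie)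

headEdge : Bool → Vertex n → Edge (suc n)
headEdge a u = a ∷ u , not a ∷ u , dist-head-flip a
  where
  dist-head-flip : ∀ a → dist (a ∷ u) (not a ∷ u) ≡ 1
  dist-head-flip false = cong suc (dist-refl u)
  dist-head-flip true  = cong suc (dist-refl u)

edgeDist-headEdge : ∀ a c (u t : Vertex n) → edgeDist (headEdge a u) (c ∷ t) ≡ dist u t
edgeDist-headEdge false false u t = m≤n⇒m⊓n≡m (n≤1+n (dist u t))
edgeDist-headEdge false true  u t = m≥n⇒m⊓n≡n (n≤1+n (dist u t))
edgeDist-headEdge true  false u t = m≥n⇒m⊓n≡n (n≤1+n (dist u t))
edgeDist-headEdge true  true  u t = m≤n⇒m⊓n≡m (n≤1+n (dist u t))

headEdge-resolved : ∀ a (u v : Vertex n) t →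
  dist (a ∷ u) t ≡ dist (a ∷ v) t → edgeDist (headEdge a u) t ≡ edgeDist (headEdge a v) t
headEdge-resolved a u v (c ∷ t) tie = begin
  edgeDist (headEdge a u) (c ∷ t) ≡⟨ edgeDist-headEdge a c u t ⟩
  dist u t                        ≡⟨ dist-∷-cancel a c u v t tie ⟩
  dist v t                        ≡⟨ edgeDist-headEdge a c v t ⟨
  edgeDist (headEdge a v) (c ∷ t) ∎
  where open ≡-Reasoning

headEdge-distinct : ∀ a (u v : Vertex n) → a ∷ u ≢ a ∷ v → ¬ SameEdge (headEdge a u) (headEdge a v)
headEdge-distinct a u v u≢v (inj₁ (u≡v , _)) = u≢v u≡v
headEdge-distinct a u v u≢v (inj₂ (au≡¬av , _)) = not-¬ refl (∷-injectiveˡ au≡¬av)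

lemma3 : (n : ℕ) → (S : List (Vertex (suc n))) → IsEdgeMetricGenerator S →
    (s : Vertex (suc n)) → s ∈ S → IsMetricGenerator ((s ⊕ α₁) ∷ S)
lemma3 n S resolves-edges s s∈S (a ∷ u) (b ∷ v) u≢v with dist (a ∷ u) s ≟ dist (b ∷ v) s
... | no s-resolves = s , there s∈S , s-resolves
... | yes s-ties with a Bool.≟ b
...   | no a≢b = s ⊕ α₁ , here refl , ⊕-α₁-resolves u v s a≢b s-ties
...   | yes refl with resolves-edges (headEdge a u) (headEdge a v) (headEdge-distinct a u v u≢v)
...     | t , t∈S , t-resolves = t , there t∈S , λ tie → t-resolves (headEdge-resolved a u v t tie)
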